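{- Let $D>1$ be a squarefree integer, $K=\mathbb{Q}(\sqrt{D})$, and $\mathcal{O}_K=\mathbb{Z}[\delta]$ its ring of integers, where $\delta=-\sqrt{D}$ if $D\not\equiv 1 \pmod 4$ and $\delta=\frac{1-\sqrt{D}}{2}$ if $D\equiv 1\pmod 4$. There can be at most finitely many ideals in $\mathcal{O}_K$, up to similarity of the resulting ideal lattices, whose canonical basis is WR twistable. Moreover, if the canonical basis $a,\ b+g\delta$ of some ideal $I\subseteq\mathcal{O}_K$ is WR twistable, then $$b<\begin{cases} g\sqrt{D} & \text{if } D\not\equiv 1 \pmod 4,\\ \frac{(\sqrt{D}-1)g}{2} & \text{if } D\equiv 1\pmod 4.\end{cases}$$ Finally, the canonical basis of $\mathcal{O}_K$ itself is WR twistable if and only if $K=\mathbb{Q}(\sqrt{5})$.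
   Context: Canonical basis: every nonzero ideal $I\subseteq\mathcal{O}_K$ can be written uniquely as $I=\{ax+(b+g\delta)y: x,y\in\mathbb{Z}\}$ with $a,b,g\in\mathbb{Z}_{\ge 0}$ satisfying $b<a$, $g\mid a$, $g\mid b$, and $ag\mid \mathbb{N}(b+g\delta)$, where $\mathbb{N}$ is the field norm; $a,\ b+g\delta$ is called the canonical basis of $I$. Let $\sigma_1,\sigma_2$ be the two real embeddings ($\sigma_1(x+y\sqrt D)=x+y\sqrt D$, $\sigma_2(x+y\sqrt D)=x-y\sqrt D$) and $\sigma_K=(\sigma_1,\sigma_2):K\to\mathbb{R}^2$. The canonical basis gives the basis matrix $B$ of the lattice $\sigma_K(I)$ with columns $\sigma_K(a)$ and $\sigma_K(b+g\delta)$. For totally positive $\alpha\in K$ (i.e. $\sigma_1(\alpha),\sigma_2(\alpha)>0$) let $A(\alpha)=\mathrm{diag}(\sqrt{\sigma_1(\alpha)},\sqrt{\sigma_2(\alpha)})$. A planar lattice is well-rounded (WR) if it has two linearly independent vectors both of length equal to its minimal nonzero vector length. A basis $v_1,v_2$ of a planar lattice is Minkowski reduced if $\|v_1\|$ is the minimal nonzero length in the lattice and $v_2$ has minimal length among vectors $x$ such that $v_1,x$ is a basis. The canonical basis is called WR twistable if there is a totally positive $\alpha\in K$ such that the columns of $A(\alpha)B$ form a Minkowski reduced basis of the WR lattice $A(\alpha)B\mathbb{Z}^2$. Two lattices are similar if they are related by a dilation composed with an orthogonal transformation. -}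

module Defs where

open import Data.Bool using (Bool; true; false; if_then_else_)
open import Data.Nat as ℕ using (ℕ)
open import Data.Nat.DivMod using (_%_; _/_)
open import Data.Nat.Divisibility as ℕD using ()
open import Data.Integer as ℤ using (ℤ; +_)
open import Data.Integer.Divisibility as ℤD using ()
open import Data.Rational as ℚ using (ℚ; 0ℚ; 1ℚ; ½)
open import Data.Product using (_×_; _,_; ∃; ∃-syntax)
open import Data.Sum using (_⊎_)
open import Data.List using (List)
open import Data.List.Relation.Unary.Any using (Any)
open import Data.List.Relation.Unary.All using (All)
open import Relation.Binary.PropositionalEquality using (_≡_)
open import Relation.Nullary using (¬_)
open import Relation.Nullary.Decidable using (does)

SquareFree : ℕ → Set
SquareFree D = ∀ (p : ℕ) → (p ℕ.* p) ℕD.∣ D → p ≡ 1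

isOneMod4 : ℕ → Bool
isOneMod4 D = does (D % 4 ℕ.≟ 1)

-- Elements of K = ℚ(√D): the pair (r , s) stands for r + s √D.

record K : Set where
  constructor _+_√D
  field
    re : ℚ
    im : ℚ
open K public

ℚ[_] : ℕ → ℚ
ℚ[ D ] = (+ D) ℚ./ 1

ℤ→ℚ : ℤ → ℚ
ℤ→ℚ x = x ℚ./ 1

mulK : ℕ → K → K → K
mulK D (r + s √D) (u + v √D) = (r ℚ.* u ℚ.+ ℚ[ D ] ℚ.* (s ℚ.* v)) + (r ℚ.* v ℚ.+ s ℚ.* u) √D

trK : K → ℚ
trK (r + s √D) = r ℚ.+ r

-- α = r + s√D is totally positive: σ₁(α) = r + s√D > 0 and σ₂(α) = r - s√D > 0,
-- which (rationally) is r > 0 and N(α) = r² - D s² > 0.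
TotallyPositive : ℕ → K → Set
TotallyPositive D (r + s √D) = (0ℚ ℚ.< r) × (0ℚ ℚ.< (r ℚ.* r ℚ.- ℚ[ D ] ℚ.* (s ℚ.* s)))

-- O_K = ℤ[δ]; δ = -√D if D ≢ 1 (mod 4), δ = (1 - √D)/2 if D ≡ 1 (mod 4).
-- ιO D x y is the element x + y δ of K.

ιO : ℕ → ℤ → ℤ → K
ιO D x y = if isOneMod4 D
             then (ℤ→ℚ x ℚ.+ ½ ℚ.* ℤ→ℚ y) + (ℚ.- (½ ℚ.* ℤ→ℚ y)) √D
             else ℤ→ℚ x + ℚ.- (ℤ→ℚ y) √D

normO : ℕ → ℤ → ℤ → ℤ
normO D x y = if isOneMod4 D
                then x ℤ.* x ℤ.+ x ℤ.* y ℤ.- (+ ((D ℕ.∸ 1) / 4)) ℤ.* (y ℤ.* y)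
                else x ℤ.* x ℤ.- (+ D) ℤ.* (y ℤ.* y)

-- Canonical bases: (a , b , g) with b < a, g ∣ a, g ∣ b, a g ∣ N(b + g δ).
-- These are exactly the canonical bases a, b + g δ of the nonzero ideals of O_K.

IsCanonical : ℕ → ℕ → ℕ → ℕ → Set
IsCanonical D a b g =
  (b ℕ.< a) × (g ℕD.∣ a) × (g ℕD.∣ b) × ((+ (a ℕ.* g)) ℤD.∣ normO D (+ b) (+ g))

latticeElt : ℕ → ℕ → ℕ → ℕ → ℤ → ℤ → K
latticeElt D a b g m n = ιO D (m ℤ.* (+ a) ℤ.+ n ℤ.* (+ b)) (n ℤ.* (+ g))

-- Squared Euclidean length of A(α) σ_K(x) for x ∈ K:
--   σ₁(α) σ₁(x)² + σ₂(α) σ₂(x)² = Tr(α x²).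
twistedNormSq : ℕ → K → K → ℚ
twistedNormSq D α x = trK (mulK D α (mulK D x x))

-- Squared length of the vector with integer coordinates (m , n) in the lattice
-- A(α) B ℤ², where B is the canonical basis matrix of the ideal (a , b , g).
QForm : Set
QForm = ℤ → ℤ → ℚ

twistForm : ℕ → K → ℕ → ℕ → ℕ → QForm
twistForm D α a b g m n = twistedNormSq D α (latticeElt D a b g m n)

idealForm : ℕ → ℕ → ℕ → ℕ → QForm
idealForm D a b g = twistForm D (1ℚ + 0ℚ √D) a b g

-- Planar lattice notions, for a lattice given by a basis (columns v₁, v₂) and the
-- squared length q m n of the lattice vector m v₁ + n v₂ (the basis is assumed
-- linearly independent, so linear (in)dependence is read off integer coordinates).

NonzeroC : ℤ → ℤ → Set
NonzeroC m n = ¬ ((m ≡ + 0) × (n ≡ + 0))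

det2 : ℤ → ℤ → ℤ → ℤ → ℤ
det2 m₁ n₁ m₂ n₂ = m₁ ℤ.* n₂ ℤ.- n₁ ℤ.* m₂

IsMinimal : QForm → ℤ → ℤ → Set
IsMinimal q m n = NonzeroC m n × (∀ m' n' → NonzeroC m' n' → q m n ℚ.≤ q m' n')

WellRounded : QForm → Set
WellRounded q = ∃[ m₁ ] ∃[ n₁ ] ∃[ m₂ ] ∃[ n₂ ]
  (¬ (det2 m₁ n₁ m₂ n₂ ≡ + 0) × IsMinimal q m₁ n₁ × IsMinimal q m₂ n₂)

-- the basis v₁ = (1,0), v₂ = (0,1) is Minkowski reduced:
-- v₁ has minimal length, and v₂ is shortest among x with v₁, x a basis
-- (x = m v₁ + n v₂ with v₁, x a basis  iff  n = ±1).
MinkowskiReducedBasis : QForm → Set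
MinkowskiReducedBasis q =
  IsMinimal q (+ 1) (+ 0) ×
  (∀ m n → (n ≡ + 1 ⊎ n ≡ ℤ.- (+ 1)) → q (+ 0) (+ 1) ℚ.≤ q m n)

WRTwistable : ℕ → ℕ → ℕ → ℕ → Set
WRTwistable D a b g = ∃[ α ]
  (TotallyPositive D α ×
   WellRounded (twistForm D α a b g) ×
   MinkowskiReducedBasis (twistForm D α a b g))

-- Similarity of planar lattices L₁ (form q₁), L₂ (form q₂): a dilation composed with an
-- orthogonal map sending L₁ onto L₂ is the same as a lattice isomorphism given by an
-- integer matrix U = (p q ; r s) with det U = ±1 multiplying all squared lengths by
-- a fixed c > 0 (c is then a ratio of squared lengths, hence rational).
Similar : QForm → QForm → Set
Similar q₁ q₂ = ∃[ c ] ∃[ p ] ∃[ q ] ∃[ r ] ∃[ s ]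
  ((0ℚ ℚ.< c) ×
   (det2 p r q s ≡ + 1 ⊎ det2 p r q s ≡ ℤ.- (+ 1)) ×
   (∀ m n → q₂ (p ℤ.* m ℤ.+ q ℤ.* n) (r ℤ.* m ℤ.+ s ℤ.* n) ≡ c ℚ.* q₁ m n))

Triple : Set
Triple = ℕ × ℕ × ℕ

CanonicalT : ℕ → Triple → Set
CanonicalT D (a , b , g) = IsCanonical D a b g

idealFormT : ℕ → Triple → QForm
idealFormT D (a , b , g) = idealForm D a b g

-- The bound on b:  b < g√D (D ≢ 1 mod 4),  b < (√D - 1) g / 2 (D ≡ 1 mod 4),
-- written equivalently (b, g ≥ 0) as  b² < g² D,  resp.  (2b + g)² < g² D.
BBound : ℕ → ℕ → ℕ → Set
BBound D b g = if isOneMod4 D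
                 then ((2 ℕ.* b ℕ.+ g) ℕ.* (2 ℕ.* b ℕ.+ g) ℕ.< g ℕ.* g ℕ.* D)
                 else (b ℕ.* b ℕ.< g ℕ.* g ℕ.* D)

module Submission where

-- Write b + gδ = βre - βim √D.  For a twist α = r + s√D the squared lengths of the
-- twisted ideal lattice form the binary quadratic form (twistForm≡twistQF)
--   q(M, N) = Tr(α (M a + N (b + gδ))²) = A M² + 2B MN + C N².
-- Minkowski reducedness of the basis says the form is reduced (A ≤ C, |2B| ≤ A), and
--   a (C - A) + βre (A - 2B) = 2ra (D βim² + a βre - a² - βre²),
-- in which the twist s cancels; so D βim² + a βre - a² - βre² ≥ 0.  Together with
-- a ≥ b + g this yields βre² < D βim², which is the bound on b, and a ≤ D g.  The
-- latter bounds the primitive basis (a/g, b/g, 1), and dividing by g is a similarity,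
-- so a finite list of primitive canonical bases represents every twistable ideal.
-- For O_K itself, well-roundedness gives a second minimal vector off the first axis;
-- in a reduced form this forces C ≤ A, impossible when D ≢ 1 (mod 4) or D ≥ 9, which
-- leaves D = 5, where the twist 5 + √5 turns O_K into a square lattice.

open import Defs
open import Data.Bool using (Bool; true; false; if_then_else_)
open import Data.Nat as ℕ using (ℕ; _<_; zero; suc; z≤n; s≤s)
open import Data.Nat.Divisibility as ℕD using (divides)
import Data.Integer.Divisibility as ℤD
open import Data.Nat.DivMod using (_/_)
open import Data.Nat.Solver renaming (module +-*-Solver to ℕSolver)
import Data.Nat.Properties as ℕP
open import Data.Integer as ℤ using (ℤ; +_; -[1+_])
import Data.Integer.Properties as ℤP
open import Data.Integer.Solver renaming (module +-*-Solver to ℤSolver)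
open import Data.Rational as ℚ using (ℚ; 0ℚ; 1ℚ; ½)
import Data.Rational.Properties as ℚP
open import Data.Rational.Unnormalised as ℚᵘ using (mkℚᵘ)
import Data.Rational.Unnormalised.Properties as ℚᵘP
open import Data.Rational.Solver
open import Data.Product using (_×_; _,_; proj₁; proj₂; ∃-syntax)
open import Data.List using (List; filter; cartesianProductWith; upTo)
open import Data.List.Relation.Unary.Any as Any using (Any)
open import Data.List.Relation.Unary.All using (All)
open import Data.List.Relation.Unary.All.Properties using (all-filter)
open import Data.List.Membership.Propositional using (_∈_)
open import Data.List.Membership.Propositional.Properties using (∈-filter⁺; ∈-cartesianProductWith⁺; ∈-upTo⁺)
open import Function.Bundles using (_⇔_; mk⇔)
open import Data.Sum using (inj₁; inj₂)
open import Data.Empty using (⊥-elim)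
open import Relation.Nullary using (¬_; yes; no; Dec)
open import Relation.Nullary.Decidable using (_×-dec_)
open import Relation.Binary.PropositionalEquality

open +-*-Solver

-- It is an
-- ordered ring homomorphism; we check this through the unnormalised rationals,
-- where ι x is literally the fraction x/1.
ι : ℤ → ℚ
ι = ℤ→ℚ

ιn : ℕ → ℚ
ιn n = ι (+ n)

ι≃ : ∀ x → ℚ.toℚᵘ (ι x) ℚᵘ.≃ mkℚᵘ x 0
ι≃ x = ℚP.toℚᵘ-fromℚᵘ (mkℚᵘ x 0)

ι-+ : ∀ x y → ι (x ℤ.+ y) ≡ ι x ℚ.+ ι y
ι-+ x y = ℚP.toℚᵘ-injective (ℚᵘP.≃-trans (ι≃ (x ℤ.+ y)) (ℚᵘP.≃-trans fractions
   (ℚᵘP.≃-sym (ℚᵘP.≃-trans (ℚP.toℚᵘ-homo-+ (ι x) (ι y)) (ℚᵘP.+-cong (ι≃ x) (ι≃ y))))))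
  where
  fractions : mkℚᵘ (x ℤ.+ y) 0 ℚᵘ.≃ (mkℚᵘ x 0 ℚᵘ.+ mkℚᵘ y 0)
  fractions = ℚᵘ.*≡* (cong (ℤ._* + 1) (sym (cong₂ ℤ._+_ (ℤP.*-identityʳ x) (ℤP.*-identityʳ y))))

ι-* : ∀ x y → ι (x ℤ.* y) ≡ ι x ℚ.* ι y
ι-* x y = ℚP.toℚᵘ-injective (ℚᵘP.≃-trans (ι≃ (x ℤ.* y)) (ℚᵘP.≃-trans fractions
   (ℚᵘP.≃-sym (ℚᵘP.≃-trans (ℚP.toℚᵘ-homo-* (ι x) (ι y)) (ℚᵘP.*-cong (ι≃ x) (ι≃ y))))))
  where
  fractions : mkℚᵘ (x ℤ.* y) 0 ℚᵘ.≃ (mkℚᵘ x 0 ℚᵘ.* mkℚᵘ y 0)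
  fractions = ℚᵘ.*≡* refl

ι-neg : ∀ x → ι (ℤ.- x) ≡ ℚ.- ι x
ι-neg x = ℚP.toℚᵘ-injective (ℚᵘP.≃-trans (ι≃ (ℤ.- x))
  (ℚᵘP.≃-sym (ℚᵘP.≃-trans (ℚP.toℚᵘ-homo‿- (ι x)) (ℚᵘP.-‿cong (ι≃ x)))))

ι-mono-≤ : ∀ {x y} → x ℤ.≤ y → ι x ℚ.≤ ι y
ι-mono-≤ {x} {y} x≤y = ℚP.toℚᵘ-cancel-≤ (ℚᵘP.≤-respˡ-≃ (ℚᵘP.≃-sym (ι≃ x)) (ℚᵘP.≤-respʳ-≃ (ℚᵘP.≃-sym (ι≃ y))
   (ℚᵘ.*≤* (subst₂ ℤ._≤_ (sym (ℤP.*-identityʳ x)) (sym (ℤP.*-identityʳ y)) x≤y))))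

ι-cancel-≤ : ∀ {x y} → ι x ℚ.≤ ι y → x ℤ.≤ y
ι-cancel-≤ {x} {y} ιx≤ιy with ℚᵘP.≤-respˡ-≃ (ι≃ x) (ℚᵘP.≤-respʳ-≃ (ι≃ y) (ℚP.toℚᵘ-mono-≤ ιx≤ιy))
... | ℚᵘ.*≤* p = subst₂ ℤ._≤_ (ℤP.*-identityʳ x) (ℤP.*-identityʳ y) p

ιn-+ : ∀ x y → ιn (x ℕ.+ y) ≡ ιn x ℚ.+ ιn y
ιn-+ x y = trans (cong ι (ℤP.pos-+ x y)) (ι-+ (+ x) (+ y))

ιn-* : ∀ x y → ιn (x ℕ.* y) ≡ ιn x ℚ.* ιn y
ιn-* x y = trans (cong ι (ℤP.pos-* x y)) (ι-* (+ x) (+ y))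

ιn-mono-≤ : ∀ {x y} → x ℕ.≤ y → ιn x ℚ.≤ ιn y
ιn-mono-≤ x≤y = ι-mono-≤ (ℤ.+≤+ x≤y)

ιn-cancel-≤ : ∀ {x y} → ιn x ℚ.≤ ιn y → x ℕ.≤ y
ιn-cancel-≤ ιx≤ιy = ℤP.drop‿+≤+ (ι-cancel-≤ ιx≤ιy)

ιn-cancel-< : ∀ {x y} → ιn x ℚ.< ιn y → x ℕ.< y
ιn-cancel-< ιx<ιy = ℕP.≰⇒> (λ y≤x → ℚP.<-irrefl refl (ℚP.<-≤-trans ιx<ιy (ιn-mono-≤ y≤x)))

0≤ιn : ∀ x → 0ℚ ℚ.≤ ιn x
0≤ιn x = ιn-mono-≤ {0} {x} z≤n

0<ιn : ∀ {x} → 1 ℕ.≤ x → 0ℚ ℚ.< ιn x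
0<ιn {x} 1≤x = ℚP.<-≤-trans (ℚ.*<* (ℤ.+<+ (s≤s z≤n))) (ιn-mono-≤ {1} {x} 1≤x)

-- Inequalities are proved by exhibiting the difference
-- as a sum of products of nonnegative quantities; `certify` transports such a
-- certificate along the ring identity that identifies it with the target.
certify : ∀ {x y} → 0ℚ ℚ.≤ x → x ≡ y → 0ℚ ℚ.≤ y
certify 0≤x refl = 0≤x

certify< : ∀ {x y} → 0ℚ ℚ.< x → x ≡ y → 0ℚ ℚ.< y
certify< 0<x refl = 0<x

0≤-diff : ∀ {x y} → x ℚ.≤ y → 0ℚ ℚ.≤ y ℚ.- x
0≤-diff {x} {y} x≤y = subst (ℚ._≤ y ℚ.- x) (ℚP.+-inverseʳ x) (ℚP.+-monoˡ-≤ (ℚ.- x) x≤y)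

diff-≤ : ∀ {x y} → 0ℚ ℚ.≤ y ℚ.- x → x ℚ.≤ y
diff-≤ {x} {y} 0≤y-x = subst₂ ℚ._≤_ (ℚP.+-identityˡ x) (solve 2 (λ x y → y :- x :+ x := y) refl x y) (ℚP.+-monoˡ-≤ x 0≤y-x)

diff-< : ∀ {x y} → 0ℚ ℚ.< y ℚ.- x → x ℚ.< y
diff-< {x} {y} 0<y-x = subst₂ ℚ._<_ (ℚP.+-identityˡ x) (solve 2 (λ x y → y :- x :+ x := y) refl x y) (ℚP.+-monoˡ-< x 0<y-x)

0≤+ : ∀ {x y} → 0ℚ ℚ.≤ x → 0ℚ ℚ.≤ y → 0ℚ ℚ.≤ x ℚ.+ y
0≤+ = ℚP.+-mono-≤

0<+ : ∀ {x y} → 0ℚ ℚ.< x → 0ℚ ℚ.≤ y → 0ℚ ℚ.< x ℚ.+ y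
0<+ = ℚP.+-mono-<-≤

0≤* : ∀ {x y} → 0ℚ ℚ.≤ x → 0ℚ ℚ.≤ y → 0ℚ ℚ.≤ x ℚ.* y
0≤* {x} {y} 0≤x 0≤y = ℚP.nonNegative⁻¹ (x ℚ.* y) {{ℚP.nonNeg*nonNeg⇒nonNeg x {{ℚ.nonNegative 0≤x}} y {{ℚ.nonNegative 0≤y}}}}

0<* : ∀ {x y} → 0ℚ ℚ.< x → 0ℚ ℚ.< y → 0ℚ ℚ.< x ℚ.* y
0<* {x} {y} 0<x 0<y = ℚP.positive⁻¹ (x ℚ.* y) {{ℚP.pos*pos⇒pos x {{ℚ.positive 0<x}} y {{ℚ.positive 0<y}}}}

0≤sq : ∀ x → 0ℚ ℚ.≤ x ℚ.* x
0≤sq x with ℚP.≤-total 0ℚ x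
... | inj₁ 0≤x = 0≤* 0≤x 0≤x
... | inj₂ x≤0 = certify (0≤* (ℚP.neg-antimono-≤ x≤0) (ℚP.neg-antimono-≤ x≤0))
                         (solve 1 (λ x → (:- x) :* (:- x) := x :* x) refl x)

cancel-0≤ : ∀ {c x} → 0ℚ ℚ.< c → 0ℚ ℚ.≤ c ℚ.* x → 0ℚ ℚ.≤ x
cancel-0≤ {c} {x} 0<c 0≤cx = ℚP.*-cancelˡ-≤-pos c {{ℚ.positive 0<c}} (subst (ℚ._≤ c ℚ.* x) (sym (ℚP.*-zeroʳ c)) 0≤cx)

1≤sq : ∀ n → ¬ (n ≡ + 0) → 1ℚ ℚ.≤ ι n ℚ.* ι n
1≤sq n n≢0 = subst (1ℚ ℚ.≤_) (ι-* n n) (ι-mono-≤ (1≤n² n n≢0))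
  where
  1≤n² : ∀ n → ¬ (n ≡ + 0) → + 1 ℤ.≤ n ℤ.* n
  1≤n² (+ zero)  n≢0 = ⊥-elim (n≢0 refl)
  1≤n² (+ suc k) _   = ℤ.+≤+ (s≤s z≤n)
  1≤n² -[1+ k ]  _   = ℤ.+≤+ (s≤s z≤n)

0≤-from-4z+1 : ∀ z → 0ℚ ℚ.≤ ι z ℚ.+ ι z ℚ.+ ι z ℚ.+ ι z ℚ.+ 1ℚ → 0ℚ ℚ.≤ ι z
0≤-from-4z+1 (+ n)      _      = 0≤ιn n
0≤-from-4z+1 -[1+ k ] 0≤4z+1 = ⊥-elim (0≰-3 (certify (0≤+ 0≤4z+1 (0≤* (0≤ιn 4) (0≤-diff z≤-1)))
    (solve 1 (λ z → z :+ z :+ z :+ z :+ con 1ℚ :+ con (ιn 4) :* (con (ℚ.- 1ℚ) :- z) := con (ℚ.- ιn 3)) refl (ι -[1+ k ]))))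
  where
  z≤-1 : ι -[1+ k ] ℚ.≤ ℚ.- 1ℚ
  z≤-1 = ι-mono-≤ { -[1+ k ]} { -[1+ 0 ]} (ℤ.-≤- z≤n)
  0≰-3 : ¬ (0ℚ ℚ.≤ ℚ.- ιn 3)
  0≰-3 (ℚ.*≤* ())

-- For integers m, n with n ≠ 0 the Eisenstein norm m² - mn + n² is at least 1:
-- 4(m² - mn + n² - 1) + 1 = (2m - n)² + 3(n² - 1) ≥ 0, and integrality does the rest.
eisensteinNorm≥1 : ∀ m n → ¬ (n ≡ + 0) → 0ℚ ℚ.≤ ι m ℚ.* ι m ℚ.- ι m ℚ.* ι n ℚ.+ ι n ℚ.* ι n ℚ.- 1ℚ
eisensteinNorm≥1 m n n≢0 = subst (0ℚ ℚ.≤_) ι-W (0≤-from-4z+1 z 0≤4W+1)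
  where
  z = m ℤ.* m ℤ.- m ℤ.* n ℤ.+ n ℤ.* n ℤ.- + 1
  M = ι m
  N = ι n
  W = M ℚ.* M ℚ.- M ℚ.* N ℚ.+ N ℚ.* N ℚ.- 1ℚ
  ι-W : ι z ≡ W
  ι-W = begin
    ι z                                                 ≡⟨ ι-+ (m ℤ.* m ℤ.- m ℤ.* n ℤ.+ n ℤ.* n) (ℤ.- + 1) ⟩
    ι (m ℤ.* m ℤ.- m ℤ.* n ℤ.+ n ℤ.* n) ℚ.- 1ℚ          ≡⟨ cong (ℚ._- 1ℚ) (ι-+ (m ℤ.* m ℤ.- m ℤ.* n) (n ℤ.* n)) ⟩
    ι (m ℤ.* m ℤ.- m ℤ.* n) ℚ.+ ι (n ℤ.* n) ℚ.- 1ℚ      ≡⟨ cong (λ u → u ℚ.+ ι (n ℤ.* n) ℚ.- 1ℚ) (ι-+ (m ℤ.* m) (ℤ.- (m ℤ.* n))) ⟩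
    ι (m ℤ.* m) ℚ.+ ι (ℤ.- (m ℤ.* n)) ℚ.+ ι (n ℤ.* n) ℚ.- 1ℚ
      ≡⟨ cong₂ (λ u v → ι (m ℤ.* m) ℚ.+ u ℚ.+ v ℚ.- 1ℚ) (trans (ι-neg (m ℤ.* n)) (cong ℚ.-_ (ι-* m n))) (ι-* n n) ⟩
    ι (m ℤ.* m) ℚ.- M ℚ.* N ℚ.+ N ℚ.* N ℚ.- 1ℚ          ≡⟨ cong (λ u → u ℚ.- M ℚ.* N ℚ.+ N ℚ.* N ℚ.- 1ℚ) (ι-* m m) ⟩
    W                                                   ∎
    where open ≡-Reasoning
  0≤4W+1 : 0ℚ ℚ.≤ ι z ℚ.+ ι z ℚ.+ ι z ℚ.+ ι z ℚ.+ 1ℚ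
  0≤4W+1 = subst (λ w → 0ℚ ℚ.≤ w ℚ.+ w ℚ.+ w ℚ.+ w ℚ.+ 1ℚ) (sym ι-W)
    (certify (0≤+ (0≤sq (M ℚ.+ M ℚ.- N)) (0≤* (0≤ιn 3) (0≤-diff (1≤sq n n≢0))))
      (solve 2 (λ M N → (M :+ M :- N) :* (M :+ M :- N) :+ con (ιn 3) :* (N :* N :- con 1ℚ)
          := let W = M :* M :- M :* N :+ N :* N :- con 1ℚ in W :+ W :+ W :+ W :+ con 1ℚ) refl M N))

-- The same bound for m² + mn + n², by the substitution m ↦ -m.
eisensteinNorm'≥1 : ∀ m n → ¬ (n ≡ + 0) → 0ℚ ℚ.≤ ι m ℚ.* ι m ℚ.+ ι m ℚ.* ι n ℚ.+ ι n ℚ.* ι n ℚ.- 1ℚ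
eisensteinNorm'≥1 m n n≢0 = certify (eisensteinNorm≥1 (ℤ.- m) n n≢0)
  (trans (cong (λ x → x ℚ.* x ℚ.- x ℚ.* ι n ℚ.+ ι n ℚ.* ι n ℚ.- 1ℚ) (ι-neg m))
         (solve 2 (λ M N → (:- M) :* (:- M) :- (:- M) :* N :+ N :* N :- con 1ℚ := M :* M :+ M :* N :+ N :* N :- con 1ℚ) refl (ι m) (ι n)))

qf : ℚ → ℚ → ℚ → ℚ → ℚ → ℚ
qf A B C M N = A ℚ.* (M ℚ.* M) ℚ.+ (B ℚ.+ B) ℚ.* (M ℚ.* N) ℚ.+ C ℚ.* (N ℚ.* N)

qf-e₁ : ∀ A B C → qf A B C 1ℚ 0ℚ ≡ A
qf-e₁ = solve 3 (λ A B C → A :* (con 1ℚ :* con 1ℚ) :+ (B :+ B) :* (con 1ℚ :* con 0ℚ) :+ C :* (con 0ℚ :* con 0ℚ) := A) refl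

qf-e₂ : ∀ A B C → qf A B C 0ℚ 1ℚ ≡ C
qf-e₂ = solve 3 (λ A B C → A :* (con 0ℚ :* con 0ℚ) :+ (B :+ B) :* (con 0ℚ :* con 1ℚ) :+ C :* (con 1ℚ :* con 1ℚ) := C) refl

Reduced : ℚ → ℚ → ℚ → Set
Reduced A B C = (A ℚ.≤ C) × (B ℚ.+ B ℚ.≤ A) × (ℚ.- (B ℚ.+ B) ℚ.≤ A)

-- e₁, e₂ is a Minkowski reduced basis for q exactly when ‖e₁‖ ≤ ‖e₂‖ ≤ ‖e₂ ± e₁‖,
-- i.e. when the form is reduced; we need the direction "⇒".
reduced-from-basis : ∀ A B C → qf A B C 1ℚ 0ℚ ℚ.≤ qf A B C 0ℚ 1ℚ →
  qf A B C 0ℚ 1ℚ ℚ.≤ qf A B C (ℚ.- 1ℚ) 1ℚ → qf A B C 0ℚ 1ℚ ℚ.≤ qf A B C 1ℚ 1ℚ → Reduced A B C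
reduced-from-basis A B C e₁≤e₂ e₂≤e₂-e₁ e₂≤e₂+e₁ =
    subst₂ ℚ._≤_ (qf-e₁ A B C) (qf-e₂ A B C) e₁≤e₂
  , diff-≤ (certify (0≤-diff (subst (ℚ._≤ qf A B C (ℚ.- 1ℚ) 1ℚ) (qf-e₂ A B C) e₂≤e₂-e₁))
      (solve 3 (λ A B C → A :* (con (ℚ.- 1ℚ) :* con (ℚ.- 1ℚ)) :+ (B :+ B) :* (con (ℚ.- 1ℚ) :* con 1ℚ) :+ C :* (con 1ℚ :* con 1ℚ) :- C
                := A :- (B :+ B)) refl A B C))
  , diff-≤ (certify (0≤-diff (subst (ℚ._≤ qf A B C 1ℚ 1ℚ) (qf-e₂ A B C) e₂≤e₂+e₁))
      (solve 3 (λ A B C → A :* (con 1ℚ :* con 1ℚ) :+ (B :+ B) :* (con 1ℚ :* con 1ℚ) :+ C :* (con 1ℚ :* con 1ℚ) :- C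
                := A :- (:- (B :+ B))) refl A B C))

-- In a reduced form A ≥ 0, since 2A = (A - 2B) + (A + 2B).
reduced-0≤A : ∀ {A B C} → Reduced A B C → 0ℚ ℚ.≤ A
reduced-0≤A {A} {B} (_ , 2B≤A , -2B≤A) = cancel-0≤ (0<ιn {2} (s≤s z≤n)) (certify (0≤+ (0≤-diff 2B≤A) (0≤-diff -2B≤A))
  (solve 2 (λ A B → (A :- (B :+ B)) :+ (A :- (:- (B :+ B))) := con (ιn 2) :* A) refl A B))

-- Depending on the sign of mn,
--   q(m,n) - C = A(m² ∓ mn + n² - 1) + (C - A)(n² - 1) + (A ± 2B)|mn|.
reduced-offAxis : ∀ A B C m n → Reduced A B C → ¬ (n ≡ + 0) → C ℚ.≤ qf A B C (ι m) (ι n)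
reduced-offAxis A B C m n red@(A≤C , 2B≤A , -2B≤A) n≢0 with ℚP.≤-total 0ℚ (ι m ℚ.* ι n)
... | inj₁ 0≤mn = diff-≤ (certify
        (0≤+ (0≤+ (0≤* (reduced-0≤A {A} {B} {C} red) (eisensteinNorm≥1 m n n≢0)) (0≤* (0≤-diff A≤C) (0≤-diff (1≤sq n n≢0))))
             (0≤* (certify (0≤-diff -2B≤A) (solve 2 (λ A B → A :- (:- (B :+ B)) := (B :+ B) :+ A) refl A B)) 0≤mn))
        (solve 5 (λ A B C M N → A :* (M :* M :- M :* N :+ N :* N :- con 1ℚ) :+ (C :- A) :* (N :* N :- con 1ℚ) :+ ((B :+ B) :+ A) :* (M :* N)
                   := A :* (M :* M) :+ (B :+ B) :* (M :* N) :+ C :* (N :* N) :- C) refl A B C (ι m) (ι n)))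
... | inj₂ mn≤0 = diff-≤ (certify
        (0≤+ (0≤+ (0≤* (reduced-0≤A {A} {B} {C} red) (eisensteinNorm'≥1 m n n≢0)) (0≤* (0≤-diff A≤C) (0≤-diff (1≤sq n n≢0))))
             (0≤* (0≤-diff 2B≤A) (ℚP.neg-antimono-≤ mn≤0)))
        (solve 5 (λ A B C M N → A :* (M :* M :+ M :* N :+ N :* N :- con 1ℚ) :+ (C :- A) :* (N :* N :- con 1ℚ) :+ (A :- (B :+ B)) :* (:- (M :* N))
                   := A :* (M :* M) :+ (B :+ B) :* (M :* N) :+ C :* (N :* N) :- C) refl A B C (ι m) (ι n)))

tA tB tC : (Dq r s a b g : ℚ) → ℚ
tA Dq r s a b g = (r ℚ.+ r) ℚ.* (a ℚ.* a)
tB Dq r s a b g = (r ℚ.+ r) ℚ.* (a ℚ.* b) ℚ.- (Dq ℚ.+ Dq) ℚ.* (s ℚ.* (a ℚ.* g))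
tC Dq r s a b g = (r ℚ.+ r) ℚ.* (b ℚ.* b ℚ.+ Dq ℚ.* (g ℚ.* g)) ℚ.- (Dq ℚ.+ Dq) ℚ.* ((s ℚ.+ s) ℚ.* (b ℚ.* g))

twistQF : (Dq r s a b g M N : ℚ) → ℚ
twistQF Dq r s a b g = qf (tA Dq r s a b g) (tB Dq r s a b g) (tC Dq r s a b g)

trace-expansion : ∀ D r s a b g M N →
  twistedNormSq D (r + s √D) ((M ℚ.* a ℚ.+ N ℚ.* b) + ℚ.- (N ℚ.* g) √D) ≡ twistQF ℚ[ D ] r s a b g M N
trace-expansion D = solve 8 (λ Dq r s a b g M N →
   let u = M :* a :+ N :* b ; v = :- (N :* g)
       re = r :* (u :* u :+ Dq :* (v :* v)) :+ Dq :* (s :* (u :* v :+ v :* u))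
   in re :+ re := (r :+ r) :* (a :* a) :* (M :* M)
        :+ ((r :+ r) :* (a :* b) :- (Dq :+ Dq) :* (s :* (a :* g)) :+ ((r :+ r) :* (a :* b) :- (Dq :+ Dq) :* (s :* (a :* g)))) :* (M :* N)
        :+ ((r :+ r) :* (b :* b :+ Dq :* (g :* g)) :- (Dq :+ Dq) :* ((s :+ s) :* (b :* g))) :* (N :* N)) refl ℚ[ D ]

twistQF-homogeneous : ∀ Dq r s a b g k M N →
  twistQF Dq r s (a ℚ.* k) (b ℚ.* k) (g ℚ.* k) M N ≡ (k ℚ.* k) ℚ.* twistQF Dq r s a b g M N
twistQF-homogeneous = solve 9 (λ Dq r s a b g k M N →
   let q = λ a b g → (r :+ r) :* (a :* a) :* (M :* M)
            :+ ((r :+ r) :* (a :* b) :- (Dq :+ Dq) :* (s :* (a :* g)) :+ ((r :+ r) :* (a :* b) :- (Dq :+ Dq) :* (s :* (a :* g)))) :* (M :* N)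
            :+ ((r :+ r) :* (b :* b :+ Dq :* (g :* g)) :- (Dq :+ Dq) :* ((s :+ s) :* (b :* g))) :* (N :* N)
   in q (a :* k) (b :* k) (g :* k) := (k :* k) :* q a b g) refl

-- δ = δ₀ - δ₁ √D: (δ₀, δ₁) = (1/2, 1/2) if D ≡ 1 (mod 4) and (0, 1) otherwise.
-- We index by the boolean isOneMod4 D so that both cases can be treated at once.
δ₀ᵇ δ₁ᵇ : Bool → ℚ
δ₀ᵇ true  = ½
δ₀ᵇ false = 0ℚ
δ₁ᵇ true  = ½
δ₁ᵇ false = 1ℚ

δ₀ δ₁ : ℕ → ℚ
δ₀ D = δ₀ᵇ (isOneMod4 D)
δ₁ D = δ₁ᵇ (isOneMod4 D)

0≤δ₀ : ∀ c → 0ℚ ℚ.≤ δ₀ᵇ c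
0≤δ₀ true  = ℚ.*≤* (ℤ.+≤+ z≤n)
0≤δ₀ false = ℚP.≤-refl

0<δ₁ : ∀ c → 0ℚ ℚ.< δ₁ᵇ c
0<δ₁ true  = ℚ.*<* (ℤ.+<+ (s≤s z≤n))
0<δ₁ false = ℚ.*<* (ℤ.+<+ (s≤s z≤n))

δ₁≤1 : ∀ c → δ₁ᵇ c ℚ.≤ 1ℚ
δ₁≤1 true  = ℚ.*≤* (ℤ.+≤+ (s≤s z≤n))
δ₁≤1 false = ℚP.≤-refl

δ₀+δ₁≡1 : ∀ c → δ₀ᵇ c ℚ.+ δ₁ᵇ c ≡ 1ℚ
δ₀+δ₁≡1 true  = refl
δ₀+δ₁≡1 false = refl

ιO-coords : ∀ D x y → ιO D x y ≡ (ι x ℚ.+ δ₀ D ℚ.* ι y) + ℚ.- (δ₁ D ℚ.* ι y) √D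
ιO-coords D x y = byCase (isOneMod4 D)
  where
  byCase : ∀ c → (if c then (ι x ℚ.+ ½ ℚ.* ι y) + ℚ.- (½ ℚ.* ι y) √D else ι x + ℚ.- (ι y) √D)
                 ≡ (ι x ℚ.+ δ₀ᵇ c ℚ.* ι y) + ℚ.- (δ₁ᵇ c ℚ.* ι y) √D
  byCase true  = refl
  byCase false = cong₂ _+_√D (solve 2 (λ x y → x := x :+ con 0ℚ :* y) refl (ι x) (ι y))
                             (solve 1 (λ y → :- y := :- (con 1ℚ :* y)) refl (ι y))

βre : ℕ → ℕ → ℕ → ℚ
βre D b g = ιn b ℚ.+ δ₀ D ℚ.* ιn g

βim : ℕ → ℕ → ℚ
βim D g = δ₁ D ℚ.* ιn g

twistForm≡twistQF : ∀ D r s a b g m n →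
  twistForm D (r + s √D) a b g m n ≡ twistQF ℚ[ D ] r s (ιn a) (βre D b g) (βim D g) (ι m) (ι n)
twistForm≡twistQF D r s a b g m n = begin
    twistForm D α a b g m n
  ≡⟨ cong (twistedNormSq D α) (ιO-coords D X Y) ⟩
    normSq (ι X ℚ.+ δ₀ D ℚ.* ι Y) (δ₁ D ℚ.* ι Y)
  ≡⟨ cong₂ (λ u v → normSq (u ℚ.+ δ₀ D ℚ.* v) (δ₁ D ℚ.* v)) ι-X (ι-* n (+ g)) ⟩
    normSq (M ℚ.* A ℚ.+ N ℚ.* ιn b ℚ.+ δ₀ D ℚ.* (N ℚ.* G)) (δ₁ D ℚ.* (N ℚ.* G))
  ≡⟨ cong₂ normSq (solve 6 (λ M N A b G h → M :* A :+ N :* b :+ h :* (N :* G) := M :* A :+ N :* (b :+ h :* G)) refl M N A (ιn b) G (δ₀ D))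
                  (solve 3 (λ N G k → k :* (N :* G) := N :* (k :* G)) refl N G (δ₁ D)) ⟩
    normSq (M ℚ.* A ℚ.+ N ℚ.* βre D b g) (N ℚ.* βim D g)
  ≡⟨ trace-expansion D r s A (βre D b g) (βim D g) M N ⟩
    twistQF ℚ[ D ] r s A (βre D b g) (βim D g) M N ∎
  where
  open ≡-Reasoning
  α = r + s √D
  X = m ℤ.* + a ℤ.+ n ℤ.* + b
  Y = n ℤ.* + g
  M = ι m
  N = ι n
  A = ιn a
  G = ιn g
  normSq : ℚ → ℚ → ℚ
  normSq u v = twistedNormSq D α (u + ℚ.- v √D)
  ι-X : ι X ≡ M ℚ.* A ℚ.+ N ℚ.* ιn b
  ι-X = trans (ι-+ (m ℤ.* + a) (n ℤ.* + b)) (cong₂ ℚ._+_ (ι-* m (+ a)) (ι-* n (+ b)))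

-- For a reduced twisted form with r > 0, a > 0, b ≥ 0 the basis data satisfy
--   D g² + ab - a² - b² ≥ 0,
-- because a(C - A) + b(A - 2B) = 2ra (D g² + ab - a² - b²): the twist s cancels.
reduced⇒discriminant : ∀ Dq r s a b g → 0ℚ ℚ.< r → 0ℚ ℚ.< a → 0ℚ ℚ.≤ b →
  Reduced (tA Dq r s a b g) (tB Dq r s a b g) (tC Dq r s a b g) →
  0ℚ ℚ.≤ Dq ℚ.* (g ℚ.* g) ℚ.+ a ℚ.* b ℚ.- a ℚ.* a ℚ.- b ℚ.* b
reduced⇒discriminant Dq r s a b g 0<r 0<a 0≤b (A≤C , 2B≤A , _) =
  cancel-0≤ (0<* (ℚP.+-mono-< 0<r 0<r) 0<a) (certify
    (0≤+ (0≤* (ℚP.<⇒≤ 0<a) (0≤-diff A≤C)) (0≤* 0≤b (0≤-diff 2B≤A)))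
    (solve 6 (λ Dq r s a b g →
       let A = (r :+ r) :* (a :* a)
           B = (r :+ r) :* (a :* b) :- (Dq :+ Dq) :* (s :* (a :* g))
           C = (r :+ r) :* (b :* b :+ Dq :* (g :* g)) :- (Dq :+ Dq) :* ((s :+ s) :* (b :* g))
       in a :* (C :- A) :+ b :* (A :- (B :+ B)) := ((r :+ r) :* a) :* (Dq :* (g :* g) :+ a :* b :- a :* a :- b :* b))
     refl Dq r s a b g))

-- With a ≥ b + g and a, g > 0, the discriminant bound gives b² < D g² and a ≤ D g:
--   D g² - b²  = disc + a(a - b - g) + a g,
--   g (D g - a) = disc + a(a - b - g) + b².
discriminant-bounds : ∀ Dq a b g → 0ℚ ℚ.< a → 0ℚ ℚ.< g → b ℚ.+ g ℚ.≤ a →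
  0ℚ ℚ.≤ Dq ℚ.* (g ℚ.* g) ℚ.+ a ℚ.* b ℚ.- a ℚ.* a ℚ.- b ℚ.* b →
  (b ℚ.* b ℚ.< Dq ℚ.* (g ℚ.* g)) × (a ℚ.≤ Dq ℚ.* g)
discriminant-bounds Dq a b g 0<a 0<g b+g≤a 0≤disc =
    diff-< (certify< (0<+ (0<* 0<a 0<g) slack)
      (solve 4 (λ Dq a b g → a :* g :+ ((Dq :* (g :* g) :+ a :* b :- a :* a :- b :* b) :+ a :* (a :- (b :+ g)))
                   := Dq :* (g :* g) :- b :* b) refl Dq a b g))
  , diff-≤ (cancel-0≤ 0<g (certify (0≤+ slack (0≤sq b))
      (solve 4 (λ Dq a b g → ((Dq :* (g :* g) :+ a :* b :- a :* a :- b :* b) :+ a :* (a :- (b :+ g))) :+ b :* b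
                   := g :* (Dq :* g :- a)) refl Dq a b g)))
  where
  slack : 0ℚ ℚ.≤ (Dq ℚ.* (g ℚ.* g) ℚ.+ a ℚ.* b ℚ.- a ℚ.* a ℚ.- b ℚ.* b) ℚ.+ a ℚ.* (a ℚ.- (b ℚ.+ g))
  slack = 0≤+ 0≤disc (0≤* (ℚP.<⇒≤ 0<a) (0≤-diff b+g≤a))

record TwistData (Dq a b g : ℚ) : Set where
  field
    r s     : ℚ
    0<r     : 0ℚ ℚ.< r
    0<Nα    : 0ℚ ℚ.< r ℚ.* r ℚ.- Dq ℚ.* (s ℚ.* s)
    reduced : Reduced (tA Dq r s a b g) (tB Dq r s a b g) (tC Dq r s a b g)
    m₀ n₀   : ℤ
    n₀≢0    : ¬ (n₀ ≡ + 0)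
    short   : twistQF Dq r s a b g (ι m₀) (ι n₀) ℚ.≤ twistQF Dq r s a b g 1ℚ 0ℚ

offAxis-of-independent : ∀ (P : ℤ → ℤ → Set) m₁ n₁ m₂ n₂ → ¬ (det2 m₁ n₁ m₂ n₂ ≡ + 0) →
  P m₁ n₁ → P m₂ n₂ → ∃[ m ] ∃[ n ] (¬ (n ≡ + 0) × P m n)
offAxis-of-independent P m₁ n₁ m₂ n₂ indep p₁ p₂ with n₁ ℤ.≟ + 0 | n₂ ℤ.≟ + 0
... | no n₁≢0  | _          = m₁ , n₁ , n₁≢0 , p₁
... | yes _    | no n₂≢0    = m₂ , n₂ , n₂≢0 , p₂
... | yes refl | yes refl   = ⊥-elim (indep (trans (cong₂ ℤ._-_ (ℤP.*-zeroʳ m₁) (ℤP.*-zeroˡ m₂)) refl))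

e₁≢0 : NonzeroC (+ 1) (+ 0)
e₁≢0 (() , _)

e₂≢0 : NonzeroC (+ 0) (+ 1)
e₂≢0 (_ , ())

unpack : ∀ {D a b g} → WRTwistable D a b g → TwistData ℚ[ D ] (ιn a) (βre D b g) (βim D g)
unpack {D} {a} {b} {g} ((r + s √D) , (0<r , 0<Nα) , (m₁ , n₁ , m₂ , n₂ , indep , min₁ , min₂) , ((_ , e₁-minimal) , e₂-shortest)) =
  record { r = r ; s = s ; 0<r = 0<r ; 0<Nα = 0<Nα
         ; reduced = reduced-from-basis (tA Dq r s A B G) (tB Dq r s A B G) (tC Dq r s A B G)
                       (compare (+ 1) (+ 0) (+ 0) (+ 1) (e₁-minimal (+ 0) (+ 1) e₂≢0))
                       (compare (+ 0) (+ 1) (ℤ.- (+ 1)) (+ 1) (e₂-shortest (ℤ.- (+ 1)) (+ 1) (inj₁ refl)))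
                       (compare (+ 0) (+ 1) (+ 1) (+ 1) (e₂-shortest (+ 1) (+ 1) (inj₁ refl)))
         ; m₀ = m₀ ; n₀ = n₀ ; n₀≢0 = n₀≢0 ; short = compare m₀ n₀ (+ 1) (+ 0) m₀≤e₁ }
  where
  Dq = ℚ[ D ]
  A = ιn a
  B = βre D b g
  G = βim D g
  q = twistForm D (r + s √D) a b g
  compare : ∀ m n m' n' → q m n ℚ.≤ q m' n' → twistQF Dq r s A B G (ι m) (ι n) ℚ.≤ twistQF Dq r s A B G (ι m') (ι n')
  compare m n m' n' = subst₂ ℚ._≤_ (twistForm≡twistQF D r s a b g m n) (twistForm≡twistQF D r s a b g m' n')
  offAxis = offAxis-of-independent (λ m n → q m n ℚ.≤ q (+ 1) (+ 0)) m₁ n₁ m₂ n₂ indep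
              (proj₂ min₁ (+ 1) (+ 0) e₁≢0) (proj₂ min₂ (+ 1) (+ 0) e₁≢0)
  m₀ = proj₁ offAxis
  n₀ = proj₁ (proj₂ offAxis)
  n₀≢0 = proj₁ (proj₂ (proj₂ offAxis))
  m₀≤e₁ = proj₂ (proj₂ (proj₂ offAxis))

-- For a canonical basis, g ≥ 1 and b + g ≤ a, since g divides both a and b < a.
canonical-gap : ∀ {D a b g} → IsCanonical D a b g → (b ℕ.+ g ℕ.≤ a) × (1 ℕ.≤ g)
canonical-gap {b = b} {g = zero} (b<a , divides qa refl , _) =
  ⊥-elim (ℕP.n≮0 (subst (b ℕ.<_) (ℕP.*-zeroʳ qa) b<a))
canonical-gap {g = suc h} (b<a , divides qa refl , divides qb refl , _) =
  subst (ℕ._≤ qa ℕ.* suc h) (ℕP.+-comm (suc h) (qb ℕ.* suc h)) (ℕP.*-monoˡ-≤ (suc h) (ℕP.*-cancelʳ-< (suc h) qb qa b<a)) , s≤s z≤n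

twistable-bounds : ∀ D a b g → IsCanonical D a b g → WRTwistable D a b g →
  (βre D b g ℚ.* βre D b g ℚ.< ℚ[ D ] ℚ.* (βim D g ℚ.* βim D g)) × (ιn a ℚ.≤ ℚ[ D ] ℚ.* βim D g)
twistable-bounds D a b g can@(b<a , _) tw =
  discriminant-bounds Dq A B G 0<A 0<G B+G≤A (reduced⇒discriminant Dq r s A B G 0<r 0<A 0≤B reduced)
  where
  open TwistData (unpack {D} {a} {b} {g} tw)
  Dq = ℚ[ D ]
  A = ιn a
  B = βre D b g
  G = βim D g
  b+g≤a×1≤g = canonical-gap {D} can
  0<A : 0ℚ ℚ.< A
  0<A = 0<ιn (ℕP.≤-trans (s≤s z≤n) b<a)
  0<G : 0ℚ ℚ.< G
  0<G = 0<* (0<δ₁ (isOneMod4 D)) (0<ιn (proj₂ b+g≤a×1≤g))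
  0≤B : 0ℚ ℚ.≤ B
  0≤B = 0≤+ (0≤ιn b) (0≤* (0≤δ₀ (isOneMod4 D)) (0≤ιn g))
  B+G≤A : B ℚ.+ G ℚ.≤ A
  B+G≤A = subst (ℚ._≤ A) B+G≡b+g (ιn-mono-≤ (proj₁ b+g≤a×1≤g))
    where
    B+G≡b+g : ιn (b ℕ.+ g) ≡ B ℚ.+ G
    B+G≡b+g = begin
      ιn (b ℕ.+ g)                                      ≡⟨ ιn-+ b g ⟩
      ιn b ℚ.+ ιn g                                     ≡⟨ cong (ιn b ℚ.+_) (sym (ℚP.*-identityˡ (ιn g))) ⟩
      ιn b ℚ.+ 1ℚ ℚ.* ιn g                               ≡⟨ cong (λ u → ιn b ℚ.+ u ℚ.* ιn g) (sym (δ₀+δ₁≡1 (isOneMod4 D))) ⟩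
      ιn b ℚ.+ (δ₀ D ℚ.+ δ₁ D) ℚ.* ιn g                  ≡⟨ solve 4 (λ b g h k → b :+ (h :+ k) :* g := (b :+ h :* g) :+ k :* g) refl (ιn b) (ιn g) (δ₀ D) (δ₁ D) ⟩
      B ℚ.+ G                                           ∎
      where open ≡-Reasoning

-- Consequently a ≤ D g: this is what makes the set of twistable ideals finite up to similarity.
twistable⇒a≤Dg : ∀ D a b g → IsCanonical D a b g → WRTwistable D a b g → a ℕ.≤ D ℕ.* g
twistable⇒a≤Dg D a b g can tw = ιn-cancel-≤ (begin
  ιn a                       ≤⟨ proj₂ (twistable-bounds D a b g can tw) ⟩
  ℚ[ D ] ℚ.* (δ₁ D ℚ.* ιn g)  ≤⟨ ℚP.*-monoˡ-≤-nonNeg ℚ[ D ] {{ℚ.nonNegative (0≤ιn D)}}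
                                   (ℚP.≤-trans (ℚP.*-monoʳ-≤-nonNeg (ιn g) {{ℚ.nonNegative (0≤ιn g)}} (δ₁≤1 (isOneMod4 D)))
                                               (ℚP.≤-reflexive (ℚP.*-identityˡ (ιn g)))) ⟩
  ℚ[ D ] ℚ.* ιn g            ≡⟨ sym (ιn-* D g) ⟩
  ιn (D ℕ.* g)               ∎)
  where open ℚP.≤-Reasoning

descend-< : ∀ {x y} k {p q} → 0ℚ ℚ.< k → ιn x ≡ k ℚ.* p → ιn y ≡ k ℚ.* q → p ℚ.< q → x ℕ.< y
descend-< k 0<k x≡kp y≡kq p<q =
  ιn-cancel-< (subst₂ ℚ._<_ (sym x≡kp) (sym y≡kq) (ℚP.*-monoʳ-<-pos k {{ℚ.positive 0<k}} p<q))

-- The bound on b of the theorem, case by case on D mod 4, is the bound βre² < D βim²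
-- cleared of denominators (multiplying by 4 when D ≡ 1 (mod 4)).
twistable⇒BBound : ∀ D a b g → IsCanonical D a b g → WRTwistable D a b g → BBound D b g
twistable⇒BBound D a b g can tw = byCase (isOneMod4 D) (proj₁ (twistable-bounds D a b g can tw))
  where
  Dq = ℚ[ D ]
  B = ιn b
  G = ιn g
  ιgD : ιn (g ℕ.* g ℕ.* D) ≡ (G ℚ.* G) ℚ.* Dq
  ιgD = trans (ιn-* (g ℕ.* g) D) (cong (ℚ._* Dq) (ιn-* g g))
  byCase : ∀ c → (B ℚ.+ δ₀ᵇ c ℚ.* G) ℚ.* (B ℚ.+ δ₀ᵇ c ℚ.* G) ℚ.< Dq ℚ.* ((δ₁ᵇ c ℚ.* G) ℚ.* (δ₁ᵇ c ℚ.* G)) →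
    if c then (2 ℕ.* b ℕ.+ g) ℕ.* (2 ℕ.* b ℕ.+ g) ℕ.< g ℕ.* g ℕ.* D else b ℕ.* b ℕ.< g ℕ.* g ℕ.* D
  byCase true  = descend-< (ιn 4) (0<ιn {4} (s≤s z≤n))
    (trans (ιn-* (2 ℕ.* b ℕ.+ g) (2 ℕ.* b ℕ.+ g)) (trans (cong₂ ℚ._*_ ι2b+g ι2b+g)
      (solve 2 (λ B G → (con (ιn 2) :* B :+ G) :* (con (ιn 2) :* B :+ G) := con (ιn 4) :* ((B :+ con ½ :* G) :* (B :+ con ½ :* G))) refl B G)))
    (trans ιgD (solve 2 (λ Dq G → (G :* G) :* Dq := con (ιn 4) :* (Dq :* ((con ½ :* G) :* (con ½ :* G)))) refl Dq G))
    where
    ι2b+g : ιn (2 ℕ.* b ℕ.+ g) ≡ ιn 2 ℚ.* B ℚ.+ G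
    ι2b+g = trans (ιn-+ (2 ℕ.* b) g) (cong (ℚ._+ G) (ιn-* 2 b))
  byCase false = descend-< 1ℚ (0<ιn {1} (s≤s z≤n))
    (trans (ιn-* b b) (solve 2 (λ B G → B :* B := con 1ℚ :* ((B :+ con 0ℚ :* G) :* (B :+ con 0ℚ :* G))) refl B G))
    (trans ιgD (solve 2 (λ Dq G → (G :* G) :* Dq := con 1ℚ :* (Dq :* ((con 1ℚ :* G) :* (con 1ℚ :* G)))) refl Dq G))

-- WR provides a minimal vector off the first axis; in the reduced form it is at least
-- as long as e₂.  Hence ‖e₂‖ ≤ ‖e₁‖, i.e. C ≤ A.
twist-C≤A : ∀ {Dq a b g} (t : TwistData Dq a b g) →
  tC Dq (TwistData.r t) (TwistData.s t) a b g ℚ.≤ tA Dq (TwistData.r t) (TwistData.s t) a b g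
twist-C≤A {Dq} {a} {b} {g} t = subst (C ℚ.≤_) (qf-e₁ A B C) (ℚP.≤-trans (reduced-offAxis A B C m₀ n₀ reduced n₀≢0) short)
  where
  open TwistData t
  A = tA Dq r s a b g
  B = tB Dq r s a b g
  C = tC Dq r s a b g

-- O_K for D ≢ 1 (mod 4): the basis 1, -√D.  Here A - C = 2r(1 - D), so C ≤ A forces D ≤ 1.
O_K-notOneMod4 : ∀ {Dq} → TwistData Dq (ιn 1) (ιn 0 ℚ.+ 0ℚ ℚ.* ιn 1) (1ℚ ℚ.* ιn 1) → Dq ℚ.≤ 1ℚ
O_K-notOneMod4 {Dq} t = diff-≤ (cancel-0≤ (ℚP.+-mono-< 0<r 0<r) (certify (0≤-diff (twist-C≤A t))
  (solve 3 (λ Dq r s → let a = con (ιn 1) ; b = con (ιn 0) :+ con 0ℚ :* con (ιn 1) ; g = con 1ℚ :* con (ιn 1)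
                        in (r :+ r) :* (a :* a) :- ((r :+ r) :* (b :* b :+ Dq :* (g :* g)) :- (Dq :+ Dq) :* ((s :+ s) :* (b :* g)))
                           := (r :+ r) :* (con 1ℚ :- Dq)) refl Dq r s)))
  where open TwistData t

-- O_K for D ≡ 1 (mod 4): the basis 1, (1 - √D)/2.  With X = D s, Y = r (D - 3)/2,
-- C ≤ A says X ≥ Y, and Y ≥ 0 once D ≥ 9; but then the identity
--   D N(α) + (X - Y)(X + Y) + (r²/4)(D - 9)(D - 1) = 0
-- has a positive first summand and nonnegative others.
O_K-oneMod4 : ∀ {Dq} → ιn 9 ℚ.≤ Dq → ¬ TwistData Dq (ιn 1) (ιn 0 ℚ.+ ½ ℚ.* ιn 1) (½ ℚ.* ιn 1)
O_K-oneMod4 {Dq} 9≤D t = ℚP.<-irrefl refl (certify< (0<+ (0<+ (0<* 0<D 0<Nα) (0≤* 0≤X-Y (0≤+ 0≤X-Y (0≤+ 0≤Y 0≤Y))))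
                                                        (0≤* (0≤* (0≤* 0≤½ 0≤½) (0≤sq r)) (0≤* 0≤D-9 (0≤+ 0≤D-9 (0≤ιn 8)))))
  (solve 3 (λ Dq r s → let X = Dq :* s ; Y = con ½ :* (r :* (Dq :- con (ιn 3))) in
     Dq :* (r :* r :- Dq :* (s :* s)) :+ (X :- Y) :* ((X :- Y) :+ (Y :+ Y))
       :+ ((con ½ :* con ½) :* (r :* r)) :* ((Dq :- con (ιn 9)) :* ((Dq :- con (ιn 9)) :+ con (ιn 8))) := con 0ℚ) refl Dq r s))
  where
  open TwistData t
  0≤½ : 0ℚ ℚ.≤ ½
  0≤½ = 0≤δ₀ true
  X = Dq ℚ.* s
  Y = ½ ℚ.* (r ℚ.* (Dq ℚ.- ιn 3))
  0≤D-9 : 0ℚ ℚ.≤ Dq ℚ.- ιn 9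
  0≤D-9 = 0≤-diff 9≤D
  0<D : 0ℚ ℚ.< Dq
  0<D = ℚP.<-≤-trans (0<ιn {9} (s≤s z≤n)) 9≤D
  0≤X-Y : 0ℚ ℚ.≤ X ℚ.- Y
  0≤X-Y = certify (0≤-diff (twist-C≤A t))
    (solve 3 (λ Dq r s → let a = con (ιn 1) ; b = con (ιn 0) :+ con ½ :* con (ιn 1) ; g = con ½ :* con (ιn 1)
                         in (r :+ r) :* (a :* a) :- ((r :+ r) :* (b :* b :+ Dq :* (g :* g)) :- (Dq :+ Dq) :* ((s :+ s) :* (b :* g)))
                            := Dq :* s :- con ½ :* (r :* (Dq :- con (ιn 3)))) refl Dq r s)
  0≤Y : 0ℚ ℚ.≤ Y
  0≤Y = 0≤* 0≤½ (0≤* (ℚP.<⇒≤ 0<r) (certify (0≤+ 0≤D-9 (0≤ιn 6))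
          (solve 1 (λ Dq → (Dq :- con (ιn 9)) :+ con (ιn 6) := Dq :- con (ιn 3)) refl Dq)))

oneMod4-below9 : ∀ D → isOneMod4 D ≡ true → 1 < D → ¬ (9 ℕ.≤ D) → D ≡ 5
oneMod4-below9 0 () _ _
oneMod4-below9 1 _ (s≤s ()) _
oneMod4-below9 2 () _ _
oneMod4-below9 3 () _ _
oneMod4-below9 4 () _ _
oneMod4-below9 5 _ _ _ = refl
oneMod4-below9 6 () _ _
oneMod4-below9 7 () _ _
oneMod4-below9 8 () _ _
oneMod4-below9 (suc (suc (suc (suc (suc (suc (suc (suc (suc n))))))))) _ _ D≱9 =
  ⊥-elim (D≱9 (s≤s (s≤s (s≤s (s≤s (s≤s (s≤s (s≤s (s≤s (s≤s z≤n))))))))))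

O_K-twistable⇒D≡5 : ∀ D → 1 < D → WRTwistable D 1 0 1 → D ≡ 5
O_K-twistable⇒D≡5 D 1<D tw = byCase (isOneMod4 D) refl (unpack {D} {1} {0} {1} tw)
  where
  byCase : ∀ c → isOneMod4 D ≡ c → TwistData ℚ[ D ] (ιn 1) (ιn 0 ℚ.+ δ₀ᵇ c ℚ.* ιn 1) (δ₁ᵇ c ℚ.* ιn 1) → D ≡ 5
  byCase false _     t = ⊥-elim (ℕP.<⇒≱ 1<D (ιn-cancel-≤ (O_K-notOneMod4 t)))
  byCase true  1mod4 t = oneMod4-below9 D 1mod4 1<D (λ 9≤D → O_K-oneMod4 (ιn-mono-≤ 9≤D) t)

-- For D = 5 the twist α = 5 + √5 turns O_K into a scaled square lattice:
-- ‖m + n δ‖² = 10 (m² + n²).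
α₅ : K
α₅ = ιn 5 + 1ℚ √D

square-twist : ∀ m n → twistForm 5 α₅ 1 0 1 m n ≡ ιn 10 ℚ.* (ι m ℚ.* ι m ℚ.+ ι n ℚ.* ι n)
square-twist m n = trans (twistForm≡twistQF 5 (ιn 5) 1ℚ 1 0 1 m n)
  (solve 2 (λ M N → let Dq = con ℚ[ 5 ] ; r = con (ιn 5) ; s = con 1ℚ
                        a = con (ιn 1) ; b = con (ιn 0) :+ con ½ :* con (ιn 1) ; g = con ½ :* con (ιn 1)
                        A = (r :+ r) :* (a :* a)
                        B = (r :+ r) :* (a :* b) :- (Dq :+ Dq) :* (s :* (a :* g))
                        C = (r :+ r) :* (b :* b :+ Dq :* (g :* g)) :- (Dq :+ Dq) :* ((s :+ s) :* (b :* g))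
                    in A :* (M :* M) :+ (B :+ B) :* (M :* N) :+ C :* (N :* N) := con (ιn 10) :* (M :* M :+ N :* N)) refl (ι m) (ι n))

-- In the square lattice every nonzero vector has m² + n² ≥ 1, so unit vectors are minimal.
1≤m²+n² : ∀ m n → NonzeroC m n → 1ℚ ℚ.≤ ι m ℚ.* ι m ℚ.+ ι n ℚ.* ι n
1≤m²+n² m n nonzero with n ℤ.≟ + 0
... | no n≢0    = ℚP.+-mono-≤ (0≤sq (ι m)) (1≤sq n n≢0)
... | yes refl  = ℚP.+-mono-≤ (1≤sq m (λ m≡0 → nonzero (m≡0 , refl))) (0≤sq (ι n))

unit-minimal : ∀ m₀ n₀ → ι m₀ ℚ.* ι m₀ ℚ.+ ι n₀ ℚ.* ι n₀ ≡ 1ℚ → ∀ m n → NonzeroC m n →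
  twistForm 5 α₅ 1 0 1 m₀ n₀ ℚ.≤ twistForm 5 α₅ 1 0 1 m n
unit-minimal m₀ n₀ unit m n nonzero = subst₂ ℚ._≤_ (sym (trans (square-twist m₀ n₀) (cong (ιn 10 ℚ.*_) unit))) (sym (square-twist m n))
  (ℚP.*-monoˡ-≤-nonNeg (ιn 10) {{ℚ.nonNegative (0≤ιn 10)}} (1≤m²+n² m n nonzero))

O_K-twistable-for-5 : WRTwistable 5 1 0 1
O_K-twistable-for-5 = α₅ , (0<ιn {5} (s≤s z≤n) , ℚ.*<* (ℤ.+<+ (s≤s z≤n)))
  , (+ 1 , + 0 , + 0 , + 1 , (λ ()) , (e₁≢0 , unit-minimal (+ 1) (+ 0) refl) , (e₂≢0 , unit-minimal (+ 0) (+ 1) refl))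
  , ((e₁≢0 , unit-minimal (+ 1) (+ 0) refl)
    , λ { m n (inj₁ refl) → unit-minimal (+ 0) (+ 1) refl m n (λ ())
        ; m n (inj₂ refl) → unit-minimal (+ 0) (+ 1) refl m n (λ ()) })

normO-homogeneous : ∀ D x y k → normO D (x ℤ.* k) (y ℤ.* k) ≡ (k ℤ.* k) ℤ.* normO D x y
normO-homogeneous D x y k = byCase (isOneMod4 D)
  where
  c = + ((D ℕ.∸ 1) / 4)
  N-oneMod4 N-otherwise : ℤ → ℤ → ℤ
  N-oneMod4 u v = u ℤ.* u ℤ.+ u ℤ.* v ℤ.- c ℤ.* (v ℤ.* v)
  N-otherwise u v = u ℤ.* u ℤ.- (+ D) ℤ.* (v ℤ.* v)
  byCase : ∀ b → (if b then N-oneMod4 (x ℤ.* k) (y ℤ.* k) else N-otherwise (x ℤ.* k) (y ℤ.* k)) ≡ (k ℤ.* k) ℤ.* (if b then N-oneMod4 x y else N-otherwise x y)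
  byCase true  = ℤSolver.solve 4 (λ x y k c →
     (x ℤSolver.:* k) ℤSolver.:* (x ℤSolver.:* k) ℤSolver.:+ (x ℤSolver.:* k) ℤSolver.:* (y ℤSolver.:* k) ℤSolver.:- c ℤSolver.:* ((y ℤSolver.:* k) ℤSolver.:* (y ℤSolver.:* k))
     ℤSolver.:= (k ℤSolver.:* k) ℤSolver.:* (x ℤSolver.:* x ℤSolver.:+ x ℤSolver.:* y ℤSolver.:- c ℤSolver.:* (y ℤSolver.:* y))) refl x y k c
  byCase false = ℤSolver.solve 4 (λ x y k d →
     (x ℤSolver.:* k) ℤSolver.:* (x ℤSolver.:* k) ℤSolver.:- d ℤSolver.:* ((y ℤSolver.:* k) ℤSolver.:* (y ℤSolver.:* k))
     ℤSolver.:= (k ℤSolver.:* k) ℤSolver.:* (x ℤSolver.:* x ℤSolver.:- d ℤSolver.:* (y ℤSolver.:* y))) refl x y k (+ D)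

primitive-canonical : ∀ D qa qb h → IsCanonical D (qa ℕ.* suc h) (qb ℕ.* suc h) (suc h) → IsCanonical D qa qb 1
primitive-canonical D qa qb h (b<a , _ , _ , ag∣N) =
  ℕP.*-cancelʳ-< (suc h) qb qa b<a , ℕD.1∣ qa , ℕD.1∣ qb ,
  ℤD.*-cancelˡ-∣ k {+ (qa ℕ.* 1)} {normO D (+ qb) (+ 1)} (subst₂ ℤD._∣_ ag≡k·a N≡k·N ag∣N)
  where
  g = suc h
  k = + g ℤ.* + g
  ag≡k·a : + (qa ℕ.* g ℕ.* g) ≡ k ℤ.* + (qa ℕ.* 1)
  ag≡k·a = trans (cong +_ (solve-ℕ qa g)) (trans (ℤP.pos-* (g ℕ.* g) (qa ℕ.* 1)) (cong (ℤ._* + (qa ℕ.* 1)) (ℤP.pos-* g g)))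
    where
    solve-ℕ : ∀ a g → a ℕ.* g ℕ.* g ≡ g ℕ.* g ℕ.* (a ℕ.* 1)
    solve-ℕ = ℕSolver.solve 2 (λ a g → a ℕSolver.:* g ℕSolver.:* g ℕSolver.:= g ℕSolver.:* g ℕSolver.:* (a ℕSolver.:* ℕSolver.con 1)) refl
  N≡k·N : normO D (+ (qb ℕ.* g)) (+ g) ≡ k ℤ.* normO D (+ qb) (+ 1)
  N≡k·N = trans (cong₂ (normO D) (ℤP.pos-* qb g) (sym (ℤP.*-identityˡ (+ g)))) (normO-homogeneous D (+ qb) (+ 1) (+ g))

idealForm-scaling : ∀ D qa qb g m n →
  idealForm D (qa ℕ.* g) (qb ℕ.* g) g m n ≡ (ιn g ℚ.* ιn g) ℚ.* idealForm D qa qb 1 m n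
idealForm-scaling D qa qb g m n = begin
    idealForm D (qa ℕ.* g) (qb ℕ.* g) g m n
  ≡⟨ twistForm≡twistQF D 1ℚ 0ℚ (qa ℕ.* g) (qb ℕ.* g) g m n ⟩
    twistQF Dq 1ℚ 0ℚ (ιn (qa ℕ.* g)) (βre D (qb ℕ.* g) g) (βim D g) M N
  ≡⟨ cong₂ (λ a b → twistQF Dq 1ℚ 0ℚ a b (βim D g) M N) (ιn-* qa g) βre-scaling ⟩
    twistQF Dq 1ℚ 0ℚ (ιn qa ℚ.* G) (βre D qb 1 ℚ.* G) (βim D g) M N
  ≡⟨ cong (λ c → twistQF Dq 1ℚ 0ℚ (ιn qa ℚ.* G) (βre D qb 1 ℚ.* G) c M N)
          (solve 2 (λ k G → k :* G := (k :* con (ιn 1)) :* G) refl (δ₁ D) G) ⟩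
    twistQF Dq 1ℚ 0ℚ (ιn qa ℚ.* G) (βre D qb 1 ℚ.* G) (βim D 1 ℚ.* G) M N
  ≡⟨ twistQF-homogeneous Dq 1ℚ 0ℚ (ιn qa) (βre D qb 1) (βim D 1) G M N ⟩
    (G ℚ.* G) ℚ.* twistQF Dq 1ℚ 0ℚ (ιn qa) (βre D qb 1) (βim D 1) M N
  ≡⟨ cong ((G ℚ.* G) ℚ.*_) (sym (twistForm≡twistQF D 1ℚ 0ℚ qa qb 1 m n)) ⟩
    (G ℚ.* G) ℚ.* idealForm D qa qb 1 m n ∎
  where
  open ≡-Reasoning
  Dq = ℚ[ D ]
  G = ιn g
  M = ι m
  N = ι n
  βre-scaling : βre D (qb ℕ.* g) g ≡ βre D qb 1 ℚ.* G
  βre-scaling = trans (cong (ℚ._+ δ₀ D ℚ.* G) (ιn-* qb g))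
    (solve 3 (λ b h G → b :* G :+ h :* G := (b :+ h :* con (ιn 1)) :* G) refl (ιn qb) (δ₀ D) G)

-- Hence the two lattices are similar (dilation by 1/g, identity on coordinates).
similar-to-primitive : ∀ D qa qb g → 1 ℕ.≤ g → Similar (idealForm D (qa ℕ.* g) (qb ℕ.* g) g) (idealForm D qa qb 1)
similar-to-primitive D qa qb g 1≤g = ℚ.1/ G² , + 1 , + 0 , + 0 , + 1 , 0<1/G² , inj₁ refl , scaled
  where
  G² = ιn g ℚ.* ιn g
  0<G² : 0ℚ ℚ.< G²
  0<G² = 0<* (0<ιn 1≤g) (0<ιn 1≤g)
  instance
    G²-pos : ℚ.Positive G²
    G²-pos = ℚ.positive 0<G²
    G²-nonzero : ℚ.NonZero G²
    G²-nonzero = ℚP.pos⇒nonZero G²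
  0<1/G² : 0ℚ ℚ.< ℚ.1/ G²
  0<1/G² = ℚP.positive⁻¹ (ℚ.1/ G²) {{ℚP.1/pos⇒pos G²}}
  scaled : ∀ m n → idealForm D qa qb 1 (+ 1 ℤ.* m ℤ.+ + 0 ℤ.* n) (+ 0 ℤ.* m ℤ.+ + 1 ℤ.* n)
                   ≡ ℚ.1/ G² ℚ.* idealForm D (qa ℕ.* g) (qb ℕ.* g) g m n
  scaled m n = begin
      idealForm D qa qb 1 (+ 1 ℤ.* m ℤ.+ + 0 ℤ.* n) (+ 0 ℤ.* m ℤ.+ + 1 ℤ.* n)
    ≡⟨ cong₂ (idealForm D qa qb 1)
               (trans (cong₂ ℤ._+_ (ℤP.*-identityˡ m) (ℤP.*-zeroˡ n)) (ℤP.+-identityʳ m))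
               (trans (cong₂ ℤ._+_ (ℤP.*-zeroˡ m) (ℤP.*-identityˡ n)) (ℤP.+-identityˡ n)) ⟩
      idealForm D qa qb 1 m n
    ≡⟨ sym (ℚP.*-identityˡ _) ⟩
      1ℚ ℚ.* idealForm D qa qb 1 m n
    ≡⟨ cong (ℚ._* idealForm D qa qb 1 m n) (sym (ℚP.*-inverseˡ G²)) ⟩
      (ℚ.1/ G² ℚ.* G²) ℚ.* idealForm D qa qb 1 m n
    ≡⟨ ℚP.*-assoc (ℚ.1/ G²) G² _ ⟩
      ℚ.1/ G² ℚ.* (G² ℚ.* idealForm D qa qb 1 m n)
    ≡⟨ cong (ℚ.1/ G² ℚ.*_) (sym (idealForm-scaling D qa qb g m n)) ⟩
      ℚ.1/ G² ℚ.* idealForm D (qa ℕ.* g) (qb ℕ.* g) g m n ∎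
    where open ≡-Reasoning

canonical? : ∀ D → (t : Triple) → Dec (CanonicalT D t)
canonical? D (a , b , g) = (b ℕ.<? a) ×-dec (g ℕD.∣? a) ×-dec (g ℕD.∣? b) ×-dec (ℤ.∣ + (a ℕ.* g) ∣ ℕD.∣? ℤ.∣ normO D (+ b) (+ g) ∣)

primitiveGrid : ℕ → List Triple
primitiveGrid D = cartesianProductWith (λ a b → a , b , 1) (upTo (suc D)) (upTo D)

candidates : ℕ → List Triple
candidates D = filter (canonical? D) (primitiveGrid D)

-- Every canonical basis with a ≤ D g is similar to a candidate: write (a, b, g) =
-- (qa g, qb g, g); then qa ≤ D, and (qa, qb, 1) is canonical.
bounded-similar-to-candidate : ∀ D a b g → IsCanonical D a b g → a ℕ.≤ D ℕ.* g →
  Any (λ t → Similar (idealForm D a b g) (idealFormT D t)) (candidates D)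
bounded-similar-to-candidate D a b zero    can _ = ⊥-elim (ℕP.<-irrefl refl (proj₂ (canonical-gap {D} can)))
bounded-similar-to-candidate D a b (suc h) can a≤Dg with can
... | (_ , divides qa refl , divides qb refl , _) =
  Any.map (λ { refl → similar-to-primitive D qa qb (suc h) (s≤s z≤n) }) candidate
  where
  primitiveBasis = primitive-canonical D qa qb h can
  qa≤D : qa ℕ.≤ D
  qa≤D = ℕP.*-cancelʳ-≤ qa D (suc h) a≤Dg
  candidate : (qa , qb , 1) ∈ candidates D
  candidate = ∈-filter⁺ (canonical? D)
    (∈-cartesianProductWith⁺ (λ a b → a , b , 1) (∈-upTo⁺ (s≤s qa≤D)) (∈-upTo⁺ (ℕP.<-≤-trans (proj₁ primitiveBasis) qa≤D)))
    primitiveBasis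

theorem1p5 : (D : ℕ) → 1 < D → SquareFree D →
    (∃[ L ] (All (CanonicalT D) L ×
        (∀ a b g → IsCanonical D a b g → WRTwistable D a b g →
           Any (λ t → Similar (idealForm D a b g) (idealFormT D t)) L)))
  × (∀ a b g → IsCanonical D a b g → WRTwistable D a b g → BBound D b g)
  × (WRTwistable D 1 0 1 ⇔ D ≡ 5)
theorem1p5 D 1<D _ =
    ( candidates D , all-filter (canonical? D) (primitiveGrid D)
    , λ a b g can tw → bounded-similar-to-candidate D a b g can (twistable⇒a≤Dg D a b g can tw))
  , twistable⇒BBound D
  , mk⇔ (O_K-twistable⇒D≡5 D 1<D) (λ { refl → O_K-twistable-for-5 })
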